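{- Let $H$ be a graph that is either isomorphic to $C_4$, isomorphic to $C_7$, or configurable, and let $u_0$ be a vertex of $H$. Let $k\ge0$ and $m\ge3$ be integers, and let $G$ be the graph with $V(G)=V(H)\cup\{u_i, w_j : 1\le i\le k, 1\le j\le m\}$ (new vertices distinct and not in $H$) and $E(G)=E(H)\cup\{u_iu_{i+1} : 0\le i\le k-1\}\cup\{u_kw_1\}\cup\{w_jw_{j+1} : 1\le j\le m-1\}\cup\{w_mw_1\}$. Then $G$ is configurable.
   Context: $C_n$ is the cycle on $n$ vertices. $[5]^2$ is the set of $2$-element subsets of $\{1,2,3,4,5\}$. A configuration on a graph $G$ is a map $f:V(G)\to[5]^2$ with $\bigcup_{u\in N[v]} f(u)=\{1,2,3,4,5\}$ for every vertex $v$, where $N[v]$ is the closed neighborhood; $G$ is configurable if it has a configuration. -}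

module Defs where

open import Data.Nat using (ℕ; suc; _≤_)
open import Data.Fin using (Fin; zero; suc; toℕ; inject₁; fromℕ)
open import Data.Fin.Subset using (Subset; _∈_; ∣_∣)
open import Data.Sum using (_⊎_; inj₁; inj₂)
open import Data.Product using (_×_; ∃; Σ)
open import Relation.Nullary using (¬_)
open import Relation.Binary.PropositionalEquality using (_≡_)
open import Function.Bundles using (_⤖_; Bijection)
open import Function.Bundles using (_⇔_)
open import Level using (0ℓ)

record SimpleGraph (V : Set) : Set₁ where
  field
    Adj    : V → V → Set
    sym    : ∀ {x y} → Adj x y → Adj y x
    irrefl : ∀ {x} → ¬ Adj x x
open SimpleGraph public

record ConfigurationOn {V : Set} (Adj : V → V → Set) : Set where
  field
    f        : V → Subset 5
    two      : ∀ v → ∣ f v ∣ ≡ 2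
    covering : ∀ (v : V) (c : Fin 5) → ∃ λ u → (u ≡ v ⊎ Adj v u) × c ∈ f u

ConfigurableRel : {V : Set} → (V → V → Set) → Set
ConfigurableRel Adj = ConfigurationOn Adj

Configurable : {V : Set} → SimpleGraph V → Set
Configurable G = ConfigurableRel (Adj G)

-- The cycle C_n on vertex set Fin n (meaningful for n ≥ 3).
-- i → i+1 (mod n) as a directed successor relation, then symmetrised.
CycleSucc : (n : ℕ) → Fin n → Fin n → Set
CycleSucc n i j = (toℕ j ≡ suc (toℕ i)) ⊎ ((suc (toℕ i) ≡ n) × (toℕ j ≡ 0))

CycleAdj : (n : ℕ) → Fin n → Fin n → Set
CycleAdj n i j = CycleSucc n i j ⊎ CycleSucc n j i

IsoToCycle : {n : ℕ} → SimpleGraph (Fin n) → ℕ → Set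
IsoToCycle {n} H p =
  Σ (Fin n ⤖ Fin p) λ φ →
    ∀ a b → Adj H a b ⇔ CycleAdj p (Bijection.to φ a) (Bijection.to φ b)

-- The graph G of the lemma.  Vertices: inj₁ h for h ∈ V(H);
-- inj₂ (inj₁ i) is u_{i+1} (i : Fin k); inj₂ (inj₂ j) is w_{j+1} (j : Fin m).
module Ext {n : ℕ} (H : SimpleGraph (Fin n)) (u0 : Fin n) (k m : ℕ) where

  V : Set
  V = Fin n ⊎ (Fin k ⊎ Fin m)

  uv : Fin (suc k) → V
  uv zero    = inj₁ u0
  uv (suc i) = inj₂ (inj₁ i)

  wv : Fin m → V
  wv j = inj₂ (inj₂ j)

  data E : V → V → Set where
    old   : ∀ {a b} → Adj H a b → E (inj₁ a) (inj₁ b)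
    path  : ∀ {x y} (i : Fin k) → x ≡ uv (inject₁ i) → y ≡ uv (suc i) → E x y
    link  : ∀ {x y} (j : Fin m) → toℕ j ≡ 0 → x ≡ uv (fromℕ k) → y ≡ wv j → E x y
    cyc   : ∀ {x y} (j j' : Fin m) → toℕ j' ≡ suc (toℕ j) → x ≡ wv j → y ≡ wv j' → E x y
    close : ∀ {x y} (j j' : Fin m) → toℕ j ≡ 0 → suc (toℕ j') ≡ m → x ≡ wv j' → y ≡ wv j → E x y

  GAdj : V → V → Set
  GAdj x y = E x y ⊎ E y x

-- The colours are Z/5.  Write arc c = {c, c+1}.  Along the path u₀ u₁ … u_k w₁ … w_m
-- the labels arc 0, arc 2, arc 4, arc 1, … make any three consecutive vertices see all
-- five colours, so every inner vertex of the tail is covered, and u₀ receives the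
-- colours 2, 3 from its successor.  The periodic pattern cannot in general be closed
-- up on the cycle, so the last three vertices w_{m-2}, w_{m-1}, w_m get special labels
-- which depend only on the colour of w_{m-3} and on that of w₁.  It remains to have a
-- labelling of H, up to a permutation of the colours, with f u₀ = {0, 1} in which
-- every vertex is covered except that u₀ may miss 2 and 3: a configuration of H is
-- such a labelling, and for C₄ and C₇ one is given explicitly.
module Submission where

open import Defs hiding (sym; irrefl)
open import Data.Nat as ℕ using (ℕ; zero; suc; _+_; _∸_; _≤_; s≤s; z≤n)
open import Data.Nat.DivMod using (_mod_)
open import Data.Nat.Properties
  using (+-∸-assoc; n∸n≡0; +-suc; suc-injective; m≤n+m; ≤-refl; ≤-trans; n≤1+n)
open import Data.Fin using (Fin; zero; suc; toℕ; inject₁; fromℕ; _≟_)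
open import Data.Fin.Properties using (all?; any?; toℕ-inject₁; toℕ-fromℕ; toℕ<n)
open import Data.Fin.Subset using (Subset; ⁅_⁆; _∪_; ∣_∣; _∈_)
open import Data.Fin.Subset.Properties using (x∈⁅x⁆; x∈p∪q⁺; _∈?_; anySubset?)
open import Data.Fin.Permutation
  using (Permutation′; _⟨$⟩ʳ_; _⟨$⟩ˡ_; inverseˡ; inverseʳ; transpose; _∘ₚ_; id)
open import Data.Vec using (_∷_; []; lookup)
open import Data.Product using (_×_; _,_; proj₁; proj₂; ∃; ∃₂)
open import Data.Product.Properties using (≡-dec)
open import Data.Sum using (_⊎_; inj₁; inj₂)
open import Data.Unit using (tt)
open import Relation.Nullary using (¬_; Dec)
open import Relation.Nullary.Decidable
  using (toWitness; toWitnessFalse; decidable-stable; _⊎-dec_; _×-dec_; _→-dec_; ¬?)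
open import Relation.Binary.PropositionalEquality
  using (_≡_; _≢_; refl; sym; trans; cong; subst; subst₂)
open import Function.Bundles using (Bijection; Equivalence)

_⊕_ _⊖_ : ∀ {n} → Fin (suc n) → Fin (suc n) → Fin (suc n)
_⊕_ {n} i j = (toℕ i + toℕ j) mod suc n
_⊖_ {n} i j = (toℕ i + (suc n ∸ toℕ j)) mod suc n

Colour : Set
Colour = Fin 5

pattern c0 = zero
pattern c1 = suc zero
pattern c2 = suc (suc zero)
pattern c3 = suc (suc (suc zero))
pattern c4 = suc (suc (suc (suc zero)))

step : Colour → Colour
step c = c ⊕ c2

Pair : Set
Pair = Colour × Colour

arc : Colour → Pair
arc c = c , c ⊕ c1

infix 4 _∈ₚ_

_∈ₚ_ : Colour → Pair → Set
c ∈ₚ (a , b) = c ≡ a ⊎ c ≡ b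

_∈ₚ?_ : ∀ c S → Dec (c ∈ₚ S)
c ∈ₚ? (a , b) = (c ≟ a) ⊎-dec (c ≟ b)

Distinct : Pair → Set
Distinct (a , b) = a ≢ b

distinct? : ∀ S → Dec (Distinct S)
distinct? (a , b) = ¬? (a ≟ b)

Covers : Pair → Pair → Pair → Set
Covers S₁ S₂ S₃ = ∀ c → c ∈ₚ S₁ ⊎ c ∈ₚ S₂ ⊎ c ∈ₚ S₃

covers? : ∀ S₁ S₂ S₃ → Dec (Covers S₁ S₂ S₃)
covers? S₁ S₂ S₃ = all? λ c → (c ∈ₚ? S₁) ⊎-dec (c ∈ₚ? S₂) ⊎-dec (c ∈ₚ? S₃)

image : Permutation′ 5 → Pair → Subset 5
image π (a , b) = ⁅ π ⟨$⟩ʳ a ⁆ ∪ ⁅ π ⟨$⟩ʳ b ⁆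

∈-image : ∀ π {c} S → c ∈ₚ S → π ⟨$⟩ʳ c ∈ image π S
∈-image π (a , b) (inj₁ refl) = x∈p∪q⁺ (inj₁ (x∈⁅x⁆ _))
∈-image π (a , b) (inj₂ refl) = x∈p∪q⁺ (inj₂ (x∈⁅x⁆ _))

∣⁅a⁆∪⁅b⁆∣≡2 : ∀ (a b : Colour) → a ≢ b → ∣ ⁅ a ⁆ ∪ ⁅ b ⁆ ∣ ≡ 2
∣⁅a⁆∪⁅b⁆∣≡2 = toWitness {a? = all? λ a → all? λ b → ¬? (a ≟ b) →-dec (∣ ⁅ a ⁆ ∪ ⁅ b ⁆ ∣ ℕ.≟ 2)} tt

∣image∣≡2 : ∀ π S → Distinct S → ∣ image π S ∣ ≡ 2
∣image∣≡2 π (a , b) a≢b = ∣⁅a⁆∪⁅b⁆∣≡2 _ _ λ πa≡πb →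
  a≢b (trans (sym (inverseˡ π)) (trans (cong (π ⟨$⟩ˡ_) πa≡πb) (inverseˡ π)))

shift : Colour → Pair → Pair
shift y (a , b) = y ⊕ a , y ⊕ b

-- Labels of the last three vertices w_{m-2}, w_{m-1}, w_m, where arc y is the label of the
-- vertex before w_{m-2} and arc x that of w₁.
closing₁ closing₂ closing₃ : Colour → Colour → Pair
closing₁ y x = shift y (lookup ((c0 , c2) ∷ (c0 , c2) ∷ (c2 , c3) ∷ (c2 , c3) ∷ (c0 , c2) ∷ []) (x ⊖ y))
closing₂ y x = shift y (lookup ((c3 , c4) ∷ (c3 , c4) ∷ (c0 , c4) ∷ (c0 , c4) ∷ (c3 , c4) ∷ []) (x ⊖ y))
closing₃ y x = shift y (lookup ((c1 , c2) ∷ (c0 , c1) ∷ (c0 , c1) ∷ (c1 , c2) ∷ (c1 , c2) ∷ []) (x ⊖ y))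

arcs-cover : ∀ w → Covers (arc w) (arc (step w)) (arc (step (step w)))
arcs-cover = toWitness {a? = all? λ w → covers? (arc w) (arc (step w)) (arc (step (step w)))} tt

arcs-closing₁-cover : ∀ w x → Covers (arc w) (arc (step w)) (closing₁ (step w) x)
arcs-closing₁-cover = toWitness {a? = all? λ w → all? λ x → covers? (arc w) (arc (step w)) (closing₁ (step w) x)} tt

arc-closing₁₂-cover : ∀ y x → Covers (arc y) (closing₁ y x) (closing₂ y x)
arc-closing₁₂-cover = toWitness {a? = all? λ y → all? λ x → covers? (arc y) (closing₁ y x) (closing₂ y x)} tt

closing₁₂₃-cover : ∀ y x → Covers (closing₁ y x) (closing₂ y x) (closing₃ y x)
closing₁₂₃-cover = toWitness {a? = all? λ y → all? λ x → covers? (closing₁ y x) (closing₂ y x) (closing₃ y x)} tt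

closing₂₃-arc-cover : ∀ y x → Covers (closing₂ y x) (closing₃ y x) (arc x)
closing₂₃-arc-cover = toWitness {a? = all? λ y → all? λ x → covers? (closing₂ y x) (closing₃ y x) (arc x)} tt

closing₁-step : ∀ y → closing₁ y (step y) ≡ arc (step y)
closing₁-step = toWitness {a? = all? λ y → ≡-dec _≟_ _≟_ (closing₁ y (step y)) (arc (step y))} tt

step-⊖-cancel : ∀ c → step (c ⊖ c2) ≡ c
step-⊖-cancel = toWitness {a? = all? λ c → step (c ⊖ c2) ≟ c} tt

step-⊖-comm : ∀ c → step c ⊖ c2 ≡ step (c ⊖ c2)
step-⊖-comm = toWitness {a? = all? λ c → (step c ⊖ c2) ≟ step (c ⊖ c2)} tt

arc-distinct : ∀ c → Distinct (arc c)
arc-distinct = toWitness {a? = all? λ c → distinct? (arc c)} tt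

closing₁-distinct : ∀ y x → Distinct (closing₁ y x)
closing₁-distinct = toWitness {a? = all? λ y → all? λ x → distinct? (closing₁ y x)} tt
closing₂-distinct : ∀ y x → Distinct (closing₂ y x)
closing₂-distinct = toWitness {a? = all? λ y → all? λ x → distinct? (closing₂ y x)} tt
closing₃-distinct : ∀ y x → Distinct (closing₃ y x)
closing₃-distinct = toWitness {a? = all? λ y → all? λ x → distinct? (closing₃ y x)} tt

back : ℕ → Colour → Colour
back zero    z = z
back (suc e) z = back e z ⊖ c2

step-back : ∀ e z → step (back (suc e) z) ≡ back e z
step-back e z = step-⊖-cancel (back e z)

back-step : ∀ e z → back e (step z) ≡ step (back e z)
back-step zero    z = refl
back-step (suc e) z = trans (cong (_⊖ c2) (back-step e z)) (step-⊖-comm (back e z))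

forward : ℕ → Colour
forward zero    = c0
forward (suc n) = step (forward n)

back-forward : ∀ n → back n (forward n) ≡ c0
back-forward zero    = refl
back-forward (suc n) = cong (_⊖ c2) (trans (back-step n (forward n)) (cong step (back-forward n)))

-- Tail labels indexed by the distance e to the last vertex w_m of a cycle of length 3 + m,
-- so that three consecutive vertices have distances 2 + e, 1 + e, e; z is the colour the
-- periodic pattern would give to w_m.
module TailLabels (m : ℕ) (z : Colour) where

  y x : Colour
  y = back 3 z
  x = back (2 + m) z

  label : ℕ → Pair
  label 0 = closing₃ y x
  label 1 = closing₂ y x
  label 2 = closing₁ y x
  label e@(suc (suc (suc _))) = arc (back e z)

  label-distinct : ∀ e → Distinct (label e)
  label-distinct 0 = closing₃-distinct y x
  label-distinct 1 = closing₂-distinct y x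
  label-distinct 2 = closing₁-distinct y x
  label-distinct (suc (suc (suc e))) = arc-distinct _

  -- For m = 0 the vertex w₁ carries closing₁, which is then an arc as well.
  label-regular : ∀ e → 2 + m ≤ e → label e ≡ arc (back e z)
  label-regular 2 (s≤s (s≤s z≤n)) = subst (λ w → closing₁ y w ≡ arc w) (step-back 2 z) (closing₁-step y)
  label-regular (suc (suc (suc e))) _ = refl

  arcs-back-cover : ∀ e → Covers (arc (back (2 + e) z)) (arc (back (1 + e) z)) (arc (back e z))
  arcs-back-cover e = subst₂ (λ u v → Covers (arc w) (arc u) (arc v))
                             (step-back (1 + e) z)
                             (trans (cong step (step-back (1 + e) z)) (step-back e z))
                             (arcs-cover w)
    where w = back (2 + e) z

  window : ∀ e → Covers (label (2 + e)) (label (1 + e)) (label e)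
  window 0 = closing₁₂₃-cover y x
  window 1 = arc-closing₁₂-cover y x
  window 2 = subst (λ w → Covers (arc (back 4 z)) (arc w) (closing₁ w x)) (step-back 3 z)
                   (arcs-closing₁-cover (back 4 z) x)
  window (suc (suc (suc e))) = arcs-back-cover (3 + e)

-- A configuration of H up to the permutation π of the colours, except that u₀ may miss
-- the colours π 2 and π 3; these will be supplied by the tail attached at u₀.
record NearConfiguration {n : ℕ} (H : SimpleGraph (Fin n)) (u₀ : Fin n) : Set where
  field
    f        : Fin n → Subset 5
    two      : ∀ v → ∣ f v ∣ ≡ 2
    π        : Permutation′ 5
    root₀    : π ⟨$⟩ʳ c0 ∈ f u₀
    root₁    : π ⟨$⟩ʳ c1 ∈ f u₀
    covering : ∀ v c → (∃ λ u → (u ≡ v ⊎ Adj H v u) × c ∈ f u) ⊎ (v ≡ u₀ × π ⟨$⟩ˡ c ∈ₚ arc c2)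

inject₁-or-fromℕ : ∀ {n} (j : Fin (suc n)) → (∃ λ i → j ≡ inject₁ i) ⊎ j ≡ fromℕ n
inject₁-or-fromℕ {zero}  zero    = inj₂ refl
inject₁-or-fromℕ {suc n} zero    = inj₁ (zero , refl)
inject₁-or-fromℕ {suc n} (suc j) with inject₁-or-fromℕ j
... | inj₁ (i , refl) = inj₁ (suc i , refl)
... | inj₂ refl       = inj₂ refl

∸-inject₁ : ∀ {n} (i : Fin n) → n ∸ toℕ (inject₁ i) ≡ suc (n ∸ suc (toℕ i))
∸-inject₁ {n} i = trans (cong (n ∸_) (toℕ-inject₁ i)) (+-∸-assoc 1 (toℕ<n i))

∸-fromℕ : ∀ n → n ∸ toℕ (fromℕ n) ≡ 0
∸-fromℕ n = trans (cong (n ∸_) (toℕ-fromℕ n)) (n∸n≡0 n)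

module Tail {n : ℕ} {H : SimpleGraph (Fin n)} {u₀ : Fin n}
            (near : NearConfiguration H u₀) (k m : ℕ) where
  open NearConfiguration near
  open Ext H u₀ k (3 + m)

  total : ℕ
  total = k + (3 + m)

  -- chosen so that u₀, at distance total, gets the label arc 0
  open TailLabels m (forward total)

  -- Distance to w_m along u₀ … u_k w₁ … w_m; the vertices of H other than u₀ get junk.
  dist : V → ℕ
  dist (inj₁ _)        = total
  dist (inj₂ (inj₁ i)) = k ∸ suc (toℕ i) + (3 + m)
  dist (inj₂ (inj₂ j)) = (2 + m) ∸ toℕ j

  dist-uv : ∀ i → dist (uv i) ≡ k ∸ toℕ i + (3 + m)
  dist-uv zero    = refl
  dist-uv (suc i) = refl

  F : V → Subset 5
  F (inj₁ h) = f h
  F (inj₂ t) = image π (label (dist (inj₂ t)))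

  Carries : V → Pair → Set
  Carries v S = ∀ c → c ∈ₚ S → π ⟨$⟩ʳ c ∈ F v

  Labelled : V → Set
  Labelled v = Carries v (label (dist v))

  relabel : ∀ {v d e} → Carries v (label d) → d ≡ e → Carries v (label e)
  relabel {v} h d≡e = subst (λ e → Carries v (label e)) d≡e h

  2+m≤total : 2 + m ≤ total
  2+m≤total = ≤-trans (n≤1+n (2 + m)) (m≤n+m (3 + m) k)

  label-total : label total ≡ arc c0
  label-total = trans (label-regular total 2+m≤total) (cong arc (back-forward total))

  labelled-uv : ∀ i → Labelled (uv i)
  labelled-uv zero    = subst (Carries (inj₁ u₀)) (sym label-total) root
    where root : Carries (inj₁ u₀) (arc c0)
          root _ (inj₁ refl) = root₀
          root _ (inj₂ refl) = root₁
  labelled-uv (suc i) = λ _ → ∈-image π _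

  labelled-wv : ∀ j → Labelled (wv j)
  labelled-wv j _ = ∈-image π _

  Precedes : V → V → Set
  Precedes l v = E l v × dist l ≡ suc (dist v)

  precedes-path : (i : Fin k) → Precedes (uv (inject₁ i)) (uv (suc i))
  precedes-path i = path i refl refl , trans (dist-uv (inject₁ i)) (cong (_+ (3 + m)) (∸-inject₁ i))

  precedes-link : Precedes (uv (fromℕ k)) (wv zero)
  precedes-link = link zero refl refl refl , trans (dist-uv (fromℕ k)) (cong (_+ (3 + m)) (∸-fromℕ k))

  precedes-cycle : (i : Fin (2 + m)) → Precedes (wv (inject₁ i)) (wv (suc i))
  precedes-cycle i = cyc (inject₁ i) (suc i) (cong suc (sym (toℕ-inject₁ i))) refl refl , ∸-inject₁ i

  Successor : V → Set
  Successor v = ∃ λ r → Precedes v r × Labelled r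

  successor-uv : ∀ i → Successor (uv i)
  successor-uv i with inject₁-or-fromℕ i
  ... | inj₁ (i′ , refl) = uv (suc i′) , precedes-path i′ , labelled-uv (suc i′)
  ... | inj₂ refl        = wv zero , precedes-link , labelled-wv zero

  successor-wv : ∀ j → Successor (wv j) ⊎ j ≡ fromℕ (2 + m)
  successor-wv j with inject₁-or-fromℕ j
  ... | inj₁ (j′ , refl) = inj₁ (wv (suc j′) , precedes-cycle j′ , labelled-wv (suc j′))
  ... | inj₂ refl        = inj₂ refl

  predecessor-wv : ∀ j → ∃ λ l → Precedes l (wv j) × Labelled l
  predecessor-wv zero    = uv (fromℕ k) , precedes-link , labelled-uv (fromℕ k)
  predecessor-wv (suc j) = wv (inject₁ j) , precedes-cycle j , labelled-wv (inject₁ j)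

  Neighbour : V → V → Set
  Neighbour v u = u ≡ v ⊎ GAdj v u

  Covered : V → Set
  Covered v = ∀ c → ∃ λ u → Neighbour v u × c ∈ F u

  reached : ∀ {u S c} → Carries u S → π ⟨$⟩ˡ c ∈ₚ S → c ∈ F u
  reached {u} h c′∈S = subst (_∈ F u) (inverseʳ π) (h _ c′∈S)

  covered-by : ∀ {v l r S₁ S₂ S₃} → Neighbour v l → Neighbour v r →
               Carries l S₁ → Carries v S₂ → Carries r S₃ → Covers S₁ S₂ S₃ → Covered v
  covered-by {v} {l} {r} v~l v~r hl hv hr cover c with cover (π ⟨$⟩ˡ c)
  ... | inj₁ c′∈S₁        = l , v~l , reached {l} hl c′∈S₁
  ... | inj₂ (inj₁ c′∈S₂) = v , inj₁ refl , reached {v} hv c′∈S₂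
  ... | inj₂ (inj₂ c′∈S₃) = r , v~r , reached {r} hr c′∈S₃

  interior-covered : ∀ {l v r} → Precedes l v → Precedes v r →
                     Labelled l → Labelled v → Labelled r → Covered v
  interior-covered {l} {v} {r} (l→v , dl) (v→r , dv) hl hv hr =
    covered-by (inj₂ (inj₂ l→v)) (inj₂ (inj₁ v→r))
               (relabel {l} hl (trans dl (cong suc dv))) (relabel {v} hv dv) hr (window (dist r))

  end-covered : Covered (wv (fromℕ (2 + m)))
  end-covered = covered-by (inj₂ (inj₂ l→v)) (inj₂ (inj₁ chord))
                           (relabel {wv (inject₁ (fromℕ (suc m)))} hl (trans dl (cong suc (∸-fromℕ (2 + m)))))
                           (relabel {wv (fromℕ (2 + m))} (labelled-wv (fromℕ (2 + m))) (∸-fromℕ (2 + m)))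
                           (subst (Carries (wv zero)) (label-regular (2 + m) ≤-refl) (labelled-wv zero))
                           (closing₂₃-arc-cover y x)
    where
    l→v = proj₁ (precedes-cycle (fromℕ (suc m)))
    dl  = proj₂ (precedes-cycle (fromℕ (suc m)))
    hl  = labelled-wv (inject₁ (fromℕ (suc m)))
    chord : E (wv (fromℕ (2 + m))) (wv zero)
    chord = close zero (fromℕ (2 + m)) refl (cong suc (toℕ-fromℕ (2 + m))) refl refl

  label-after-root : ∀ e → total ≡ suc e → label e ≡ arc c2
  label-after-root e total≡1+e = trans (label-regular e 2+m≤e) (cong arc back-e)
    where
    e≡k+[2+m] : e ≡ k + (2 + m)
    e≡k+[2+m] = suc-injective (trans (sym total≡1+e) (+-suc k (2 + m)))
    2+m≤e : 2 + m ≤ e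
    2+m≤e = subst (2 + m ≤_) (sym e≡k+[2+m]) (m≤n+m (2 + m) k)
    back-e : back e (forward total) ≡ c2
    back-e = trans (sym (step-back e _))
                   (cong step (trans (cong (λ d → back d (forward total)) (sym total≡1+e)) (back-forward total)))

  H-covered : ∀ h → Covered (inj₁ h)
  H-covered h c with covering h c
  ... | inj₁ (u , inj₁ refl , c∈) = inj₁ u , inj₁ refl , c∈
  ... | inj₁ (u , inj₂ h~u , c∈)  = inj₁ u , inj₂ (inj₁ (old h~u)) , c∈
  ... | inj₂ (refl , missing) with successor-uv zero
  ...   | r , (u₀→r , dr) , hr =
          r , inj₂ (inj₁ u₀→r) , reached {r} (subst (Carries r) (label-after-root (dist r) dr) hr) missing

  covered : ∀ v → Covered v
  covered (inj₁ h)        = H-covered h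
  covered (inj₂ (inj₁ i)) with successor-uv (suc i)
  ... | _ , v→r , hr = interior-covered (precedes-path i) v→r (labelled-uv (inject₁ i)) (labelled-uv (suc i)) hr
  covered (inj₂ (inj₂ j)) with predecessor-wv j | successor-wv j
  ... | _ , l→v , hl | inj₁ (_ , v→r , hr) = interior-covered l→v v→r hl (labelled-wv j) hr
  ... | _ | inj₂ refl = end-covered

  configuration : ConfigurationOn GAdj
  configuration = record { f = F ; two = F-two ; covering = covered }
    where
    F-two : ∀ v → ∣ F v ∣ ≡ 2
    F-two (inj₁ h) = two h
    F-two (inj₂ t) = ∣image∣≡2 π _ (label-distinct (dist (inj₂ t)))

two-elements : ∀ S → ∣ S ∣ ≡ 2 → ∃₂ λ (a b : Colour) → a ≢ b × a ∈ S × b ∈ S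
two-elements S ∣S∣≡2 = decidable-stable (has-two? S) λ none → no-counterexample (S , ∣S∣≡2 , none)
  where
  has-two? : ∀ S → Dec (∃₂ λ (a b : Colour) → a ≢ b × a ∈ S × b ∈ S)
  has-two? S = any? λ a → any? λ b → ¬? (a ≟ b) ×-dec (a ∈? S) ×-dec (b ∈? S)
  no-counterexample : ¬ ∃ λ S → ∣ S ∣ ≡ 2 × ¬ ∃₂ λ (a b : Colour) → a ≢ b × a ∈ S × b ∈ S
  no-counterexample = toWitnessFalse {a? = anySubset? λ S → (∣ S ∣ ℕ.≟ 2) ×-dec ¬? (has-two? S)} tt

-- b′ := (0 a) b differs from 0, so swapping 1 with b′ and then 0 with a sends 0 ↦ a, 1 ↦ b.
onto : Colour → Colour → Permutation′ 5
onto a b = transpose c1 (transpose c0 a ⟨$⟩ʳ b) ∘ₚ transpose c0 a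

onto-01 : ∀ a b → a ≢ b → onto a b ⟨$⟩ʳ c0 ≡ a × onto a b ⟨$⟩ʳ c1 ≡ b
onto-01 = toWitness {a? = all? λ a → all? λ b →
  ¬? (a ≟ b) →-dec ((onto a b ⟨$⟩ʳ c0 ≟ a) ×-dec (onto a b ⟨$⟩ʳ c1 ≟ b))} tt

configuration⇒near : ∀ {n} {H : SimpleGraph (Fin n)} {u₀} → Configurable H → NearConfiguration H u₀
configuration⇒near {u₀ = u₀} conf = near (two-elements (f u₀) (two u₀))
  where
  open ConfigurationOn conf
  near : (∃₂ λ a b → a ≢ b × a ∈ f u₀ × b ∈ f u₀) → NearConfiguration _ u₀
  near (a , b , a≢b , a∈ , b∈) = record
    { f        = f
    ; two      = two
    ; π        = onto a b
    ; root₀    = subst (_∈ f u₀) (sym (proj₁ (onto-01 a b a≢b))) a∈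
    ; root₁    = subst (_∈ f u₀) (sym (proj₂ (onto-01 a b a≢b))) b∈
    ; covering = λ v c → inj₁ (covering v c)
    }

-- row (x ⊖ a) is the label of the vertex x of the cycle when the tail hangs at a.
RowCovers : ∀ {N} → (Fin (suc N) → Pair) → Set
RowCovers {N} row = ∀ a x c →
  (∃ λ y → (y ≡ x ⊎ CycleAdj (suc N) x y) × c ∈ₚ row (y ⊖ a)) ⊎ (x ≡ a × c ∈ₚ arc c2)

row-covers? : ∀ {N} (row : Fin (suc N) → Pair) → Dec (RowCovers row)
row-covers? {N} row = all? λ a → all? λ x → all? λ c →
  (any? λ y → ((y ≟ x) ⊎-dec adjacent? x y) ×-dec (c ∈ₚ? row (y ⊖ a))) ⊎-dec ((x ≟ a) ×-dec (c ∈ₚ? arc c2))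
  where
  successor? : ∀ i j → Dec (CycleSucc (suc N) i j)
  successor? i j = (toℕ j ℕ.≟ suc (toℕ i)) ⊎-dec ((suc (toℕ i) ℕ.≟ suc N) ×-dec (toℕ j ℕ.≟ 0))
  adjacent? : ∀ i j → Dec (CycleAdj (suc N) i j)
  adjacent? i j = successor? i j ⊎-dec successor? j i

cycle⇒near : ∀ {n N} {H : SimpleGraph (Fin n)} {u₀} (row : Fin (suc N) → Pair) →
             (∀ i → Distinct (row i)) → (∀ a → row (a ⊖ a) ≡ arc c0) → RowCovers row →
             IsoToCycle H (suc N) → NearConfiguration H u₀
cycle⇒near {n} {N} {H} {u₀} row row-distinct row-root row-covers (φ , iso) = record
  { f        = f
  ; two      = λ h → ∣image∣≡2 id _ (row-distinct (to h ⊖ to u₀))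
  ; π        = id
  ; root₀    = root (inj₁ refl)
  ; root₁    = root (inj₂ refl)
  ; covering = covering
  }
  where
  open Bijection φ using (to; injective; strictlySurjective)
  f : Fin n → Subset 5
  f h = image id (row (to h ⊖ to u₀))
  root : ∀ {c} → c ∈ₚ arc c0 → c ∈ f u₀
  root {c} c∈ = subst (λ S → c ∈ image id S) (sym (row-root (to u₀))) (∈-image id (arc c0) c∈)
  covering : ∀ h c → (∃ λ u → (u ≡ h ⊎ Adj H h u) × c ∈ f u) ⊎ (h ≡ u₀ × c ∈ₚ arc c2)
  covering h c with row-covers (to u₀) (to h) c
  ... | inj₁ (_ , inj₁ refl , c∈) = inj₁ (h , inj₁ refl , ∈-image id _ c∈)
  ... | inj₁ (y , inj₂ h~y , c∈) with strictlySurjective y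
  ...   | h′ , refl = inj₁ (h′ , inj₂ (Equivalence.from (iso h h′) h~y) , ∈-image id _ c∈)
  covering h c | inj₂ (h≡u₀ , missing) = inj₂ (injective h≡u₀ , missing)

row₄ : Fin 4 → Pair
row₄ = lookup (arc c0 ∷ (c0 , c4) ∷ (c2 , c3) ∷ (c1 , c4) ∷ [])

row₇ : Fin 7 → Pair
row₇ = lookup (arc c0 ∷ (c0 , c2) ∷ (c3 , c4) ∷ (c1 , c2) ∷ (c0 , c1) ∷ (c3 , c4) ∷ (c2 , c4) ∷ [])

C₄⇒near : ∀ {n} {H : SimpleGraph (Fin n)} {u₀} → IsoToCycle H 4 → NearConfiguration H u₀
C₄⇒near = cycle⇒near row₄
  (toWitness {a? = all? λ i → distinct? (row₄ i)} tt)
  (toWitness {a? = all? λ a → ≡-dec _≟_ _≟_ (row₄ (a ⊖ a)) (arc c0)} tt)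
  (toWitness {a? = row-covers? row₄} tt)

C₇⇒near : ∀ {n} {H : SimpleGraph (Fin n)} {u₀} → IsoToCycle H 7 → NearConfiguration H u₀
C₇⇒near = cycle⇒near row₇
  (toWitness {a? = all? λ i → distinct? (row₇ i)} tt)
  (toWitness {a? = all? λ a → ≡-dec _≟_ _≟_ (row₇ (a ⊖ a)) (arc c0)} tt)
  (toWitness {a? = row-covers? row₇} tt)

lemma2p4 : (n : ℕ) (H : SimpleGraph (Fin n)) →
           (IsoToCycle H 4 ⊎ IsoToCycle H 7 ⊎ Configurable H) →
           (u0 : Fin n) (k m : ℕ) → 3 ≤ m →
           ConfigurableRel (Ext.GAdj H u0 k m)
lemma2p4 n H hyp u0 k .(3 + m) (s≤s (s≤s (s≤s {n = m} _))) = Tail.configuration (near hyp) k m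
  where
  near : IsoToCycle H 4 ⊎ IsoToCycle H 7 ⊎ Configurable H → NearConfiguration H u0
  near (inj₁ C₄)        = C₄⇒near C₄
  near (inj₂ (inj₁ C₇)) = C₇⇒near C₇
  near (inj₂ (inj₂ C))  = configuration⇒near C
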